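{- Let the alphabet be $\mathcal{A}=\{0,1,\dots,q-1\}$ with $G=\mathbb{Z}_q$ acting by $g\cdot i=g+i\pmod q$ letterwise on words. For every pattern $p$ (of length at least $2$), $$\mathcal{G}(z,\{p\})=1+qz\,G(z,\{S(p)\}),\qquad \mathcal{G}_p(z,\{p\})=qz\,G_{S(p)}(z,\{S(p)\}).$$
   Context: A pattern is a $G$-orbit of words. $\mathcal{G}(z,\{p\})=\sum_n\mathcal{A}(n,\{p\})z^n$ and $\mathcal{G}_p(z,\{p\})=\sum_n\mathcal{T}_p(n,\{p\})z^n$, where $\mathcal{A}(n,\{p\})$ counts words of length $n$ with no factor in the orbit $p$ and $\mathcal{T}_p(n,\{p\})$ counts words of length $n$ whose only factor in the orbit $p$ is at the very end. For a word $w$, $G(z,\{w\})=\sum_nA(n,\{w\})z^n$ and $G_w(z,\{w\})=\sum_nT_w(n,\{w\})z^n$, where $A(n,\{w\})$ counts words of length $n$ avoiding $w$ as a factor and $T_w(n,\{w\})$ counts words of length $n$ whose only occurrence of $w$ is at the end. The adjacency signature of $p=p(1)\cdots p(\ell)$, $\ell\ge2$, is the word $S(p)=s(1)\cdots s(\ell-1)$ with $s(i)\equiv p(i+1)-p(i)\pmod q$. -}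

module Defs where

open import Data.Nat using (ℕ; zero; suc; _+_; _*_; _∸_; _≤_; _≤?_; NonZero)
import Data.Nat.Properties as ℕP
open import Data.Nat.DivMod using (_mod_)
open import Data.Fin using (Fin; toℕ)
import Data.Fin.Properties as FinP
open import Data.List using (List; []; _∷_; [_]; length; take; drop; map; concatMap; filter; upTo; allFin)
import Data.List.Properties as ListP
open import Data.Product using (Σ; _×_; _,_)
open import Relation.Binary.PropositionalEquality using (_≡_)
open import Relation.Nullary using (Dec; ¬_)
open import Relation.Nullary.Decidable using (_×-dec_; ¬?)
open import Relation.Unary using (Decidable)

Word : ℕ → Set
Word q = List (Fin q)

words : (q n : ℕ) → List (Word q)
words q zero    = [] ∷ []
words q (suc n) = concatMap (λ a → map (a ∷_) (words q n)) (allFin q)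

countWords : (q n : ℕ) {P : Word q → Set} → Decidable P → ℕ
countWords q n P? = length (filter P? (words q n))

module _ (q : ℕ) .{{_ : NonZero q}} where

  actLetter : Fin q → Fin q → Fin q
  actLetter g a = (toℕ g + toℕ a) mod q

  act : Fin q → Word q → Word q
  act g w = map (actLetter g) w

  -- (b - a) mod q
  diffLetter : Fin q → Fin q → Fin q
  diffLetter a b = (toℕ b + (q ∸ toℕ a)) mod q

  -- adjacency signature S(p) = s(1)…s(ℓ-1), s(i) ≡ p(i+1) - p(i) (mod q)
  signature : Word q → Word q
  signature []            = []
  signature (a ∷ [])      = []
  signature (a ∷ b ∷ rest) = diffLetter a b ∷ signature (b ∷ rest)

module _ {q : ℕ} where

  OccursAt : Word q → Word q → ℕ → Set
  OccursAt w x i = (i + length w ≤ length x) × (take (length w) (drop i x) ≡ w)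

  occursAt? : (w x : Word q) → Decidable (OccursAt w x)
  occursAt? w x i = (i + length w ≤? length x) ×-dec
                    ListP.≡-dec FinP._≟_ (take (length w) (drop i x)) w

  occurrences : Word q → Word q → List ℕ
  occurrences w x = filter (occursAt? w x) (upTo (suc (length x)))

module _ (q : ℕ) .{{_ : NonZero q}} where

  OrbitOccursAt : Word q → Word q → ℕ → Set
  OrbitOccursAt p x i = Σ (Fin q) λ g → OccursAt (act q g p) x i

  orbitOccursAt? : (p x : Word q) → Decidable (OrbitOccursAt p x)
  orbitOccursAt? p x i = FinP.any? (λ g → occursAt? (act q g p) x i)

  orbitOccurrences : Word q → Word q → List ℕ
  orbitOccurrences p x = filter (orbitOccursAt? p x) (upTo (suc (length x)))

module _ (q : ℕ) .{{_ : NonZero q}} where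

  Avoids : Word q → Word q → Set
  Avoids w x = occurrences w x ≡ []

  OnlyAtEnd : Word q → Word q → Set
  OnlyAtEnd w x = occurrences w x ≡ [ length x ∸ length w ]

  AvoidsOrbit : Word q → Word q → Set
  AvoidsOrbit p x = orbitOccurrences q p x ≡ []

  OrbitOnlyAtEnd : Word q → Word q → Set
  OrbitOnlyAtEnd p x = orbitOccurrences q p x ≡ [ length x ∸ length p ]

  private
    ℕList≟ = ListP.≡-dec ℕP._≟_

  A : Word q → ℕ → ℕ
  A w n = countWords q n (λ x → ℕList≟ (occurrences w x) [])

  T : Word q → ℕ → ℕ
  T w n = countWords q n (λ x → ℕList≟ (occurrences w x) [ length x ∸ length w ])

  𝒜 : Word q → ℕ → ℕ
  𝒜 p n = countWords q n (λ x → ℕList≟ (orbitOccurrences q p x) [])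

  𝒯 : Word q → ℕ → ℕ
  𝒯 p n = countWords q n (λ x → ℕList≟ (orbitOccurrences q p x) [ length x ∸ length p ])

-- Formal power series with ℕ coefficients, as coefficient sequences

FPS : Set
FPS = ℕ → ℕ

𝟙 : FPS
𝟙 zero    = 1
𝟙 (suc n) = 0

_+ˢ_ : FPS → FPS → FPS
(f +ˢ g) n = f n + g n

_·ˢ_ : ℕ → FPS → FPS
(c ·ˢ f) n = c * f n

z·_ : FPS → FPS
(z· f) zero    = 0
(z· f) (suc n) = f n

infixl 6 _+ˢ_
infixr 7 _·ˢ_
infixr 8 z·_

_≈ˢ_ : FPS → FPS → Set
f ≈ˢ g = ∀ n → f n ≡ g n

infix 4 _≈ˢ_

module _ (q : ℕ) .{{_ : NonZero q}} where
  GF : Word q → FPS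
  GF w = A q w
  GF-end : Word q → FPS
  GF-end w = T q w
  𝒢 : Word q → FPS
  𝒢 p = 𝒜 q p
  𝒢-end : Word q → FPS
  𝒢-end p = 𝒯 q p

-- Two nonempty words have the same adjacency signature exactly when one is a translate of the other,
-- so a factor of x = a ∷ y lies in the orbit of p at position i iff S(p) occurs in S(x) at
-- position i: the orbit-occurrences of p in x are the occurrences of S(p) in S(x).
-- For a fixed first letter a, y ↦ S(a ∷ y) permutes the words of length n (by induction,
-- the next letter b only enters through b − a), so summing over the q first letters turns
-- a count for S(p) at length n into q times it for p at length n + 1.

module Submission where

open import Defs
open import Data.Nat using (ℕ; zero; suc; _+_; _*_; _∸_; _%_; _≤_; NonZero; s≤s)
import Data.Nat.Properties as ℕP
open import Data.Nat.DivMod using (%-distribˡ-+; m%n%n≡m%n; [m+n]%n≡m%n; m<n⇒m%n≡m)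
open import Data.Fin as Fin using (Fin; toℕ)
import Data.Fin.Properties as FinP
open import Data.Fin.Permutation using (permutation)
open import Data.List
  using (List; []; _∷_; [_]; _++_; _∷ʳ_; length; take; drop; map; filter; upTo; concatMap; tabulate)
import Data.List.Properties as LP
open import Data.Product using (Σ; _×_; _,_)
open import Data.Bool using (true; false)
open import Function using (_∘_; id; case_of_)
open import Function.Bundles using (_⇔_; mk⇔; Equivalence)
open import Relation.Nullary using (¬_; does; yes; no)
open import Relation.Unary using (Pred; Decidable)
open import Relation.Binary.PropositionalEquality
  using (_≡_; refl; sym; trans; cong; cong₂; subst; subst₂; module ≡-Reasoning)
open import Algebra.Properties.CommutativeMonoid.Sum ℕP.+-0-commutativeMonoid
  using (sum; sum-cong-≗; sum-permute)
open ≡-Reasoning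
open Equivalence using (to; from)

[m%d+n]%d≡[m+n]%d : ∀ m n d .{{_ : NonZero d}} → (m % d + n) % d ≡ (m + n) % d
[m%d+n]%d≡[m+n]%d m n d = begin
  (m % d + n) % d         ≡⟨ %-distribˡ-+ (m % d) n d ⟩
  (m % d % d + n % d) % d ≡⟨ cong (λ t → (t + n % d) % d) (m%n%n≡m%n m d) ⟩
  (m % d + n % d) % d     ≡⟨ %-distribˡ-+ m n d ⟨
  (m + n) % d             ∎

[m+n%d]%d≡[m+n]%d : ∀ m n d .{{_ : NonZero d}} → (m + n % d) % d ≡ (m + n) % d
[m+n%d]%d≡[m+n]%d m n d = begin
  (m + n % d) % d ≡⟨ cong (_% d) (ℕP.+-comm m (n % d)) ⟩
  (n % d + m) % d ≡⟨ [m%d+n]%d≡[m+n]%d n m d ⟩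
  (n + m) % d     ≡⟨ cong (_% d) (ℕP.+-comm n m) ⟩
  (m + n) % d     ∎

module _ {q : ℕ} .{{_ : NonZero q}} where

  toℕ-actLetter : ∀ g a → toℕ (actLetter q g a) ≡ (toℕ g + toℕ a) % q
  toℕ-actLetter g a = FinP.toℕ-fromℕ< _

  toℕ-diffLetter : ∀ a b → toℕ (diffLetter q a b) ≡ (toℕ b + (q ∸ toℕ a)) % q
  toℕ-diffLetter a b = FinP.toℕ-fromℕ< _

  toℕ-%-cancel : (a : Fin q) → toℕ a % q ≡ toℕ a
  toℕ-%-cancel a = m<n⇒m%n≡m (FinP.toℕ<n a)

  +-inverse-%-cancel : ∀ m (a : Fin q) → (m + ((q ∸ toℕ a) + toℕ a)) % q ≡ m % q
  +-inverse-%-cancel m a = begin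
    (m + ((q ∸ toℕ a) + toℕ a)) % q ≡⟨ cong (λ t → (m + t) % q) (ℕP.m∸n+n≡m (ℕP.<⇒≤ (FinP.toℕ<n a))) ⟩
    (m + q) % q                     ≡⟨ [m+n]%n≡m%n m q ⟩
    m % q                           ∎

  actLetter-comm : ∀ g a → actLetter q g a ≡ actLetter q a g
  actLetter-comm g a = FinP.toℕ-injective (begin
    toℕ (actLetter q g a) ≡⟨ toℕ-actLetter g a ⟩
    (toℕ g + toℕ a) % q   ≡⟨ cong (_% q) (ℕP.+-comm (toℕ g) (toℕ a)) ⟩
    (toℕ a + toℕ g) % q   ≡⟨ toℕ-actLetter a g ⟨
    toℕ (actLetter q a g) ∎)

  actLetter-assoc : ∀ g h a → actLetter q (actLetter q g h) a ≡ actLetter q g (actLetter q h a)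
  actLetter-assoc g h a = FinP.toℕ-injective (begin
    toℕ (actLetter q (actLetter q g h) a) ≡⟨ toℕ-actLetter _ a ⟩
    (toℕ (actLetter q g h) + a′) % q      ≡⟨ cong (λ t → (t + a′) % q) (toℕ-actLetter g h) ⟩
    ((g′ + h′) % q + a′) % q              ≡⟨ [m%d+n]%d≡[m+n]%d _ a′ q ⟩
    (g′ + h′ + a′) % q                    ≡⟨ cong (_% q) (ℕP.+-assoc g′ h′ a′) ⟩
    (g′ + (h′ + a′)) % q                  ≡⟨ [m+n%d]%d≡[m+n]%d g′ _ q ⟨
    (g′ + (h′ + a′) % q) % q              ≡⟨ cong (λ t → (g′ + t) % q) (toℕ-actLetter h a) ⟨
    (g′ + toℕ (actLetter q h a)) % q      ≡⟨ toℕ-actLetter g _ ⟨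
    toℕ (actLetter q g (actLetter q h a)) ∎)
    where g′ = toℕ g; h′ = toℕ h; a′ = toℕ a

  actLetter-diffLetter : ∀ a b → actLetter q a (diffLetter q a b) ≡ b
  actLetter-diffLetter a b = FinP.toℕ-injective (begin
    toℕ (actLetter q a (diffLetter q a b)) ≡⟨ toℕ-actLetter a _ ⟩
    (a′ + toℕ (diffLetter q a b)) % q      ≡⟨ cong (λ t → (a′ + t) % q) (toℕ-diffLetter a b) ⟩
    (a′ + (b′ + (q ∸ a′)) % q) % q         ≡⟨ [m+n%d]%d≡[m+n]%d a′ _ q ⟩
    (a′ + (b′ + (q ∸ a′))) % q             ≡⟨ cong (_% q) (ℕP.+-comm a′ _) ⟩
    (b′ + (q ∸ a′) + a′) % q               ≡⟨ cong (_% q) (ℕP.+-assoc b′ _ a′) ⟩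
    (b′ + ((q ∸ a′) + a′)) % q             ≡⟨ +-inverse-%-cancel b′ a ⟩
    b′ % q                                 ≡⟨ toℕ-%-cancel b ⟩
    b′                                     ∎)
    where a′ = toℕ a; b′ = toℕ b

  diffLetter-actLetter : ∀ a c → diffLetter q a (actLetter q a c) ≡ c
  diffLetter-actLetter a c = FinP.toℕ-injective (begin
    toℕ (diffLetter q a (actLetter q a c)) ≡⟨ toℕ-diffLetter a _ ⟩
    (toℕ (actLetter q a c) + (q ∸ a′)) % q ≡⟨ cong (λ t → (t + (q ∸ a′)) % q) (toℕ-actLetter a c) ⟩
    ((a′ + c′) % q + (q ∸ a′)) % q         ≡⟨ [m%d+n]%d≡[m+n]%d _ (q ∸ a′) q ⟩
    (a′ + c′ + (q ∸ a′)) % q               ≡⟨ cong (λ t → (t + (q ∸ a′)) % q) (ℕP.+-comm a′ c′) ⟩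
    (c′ + a′ + (q ∸ a′)) % q               ≡⟨ cong (_% q) (ℕP.+-assoc c′ a′ _) ⟩
    (c′ + (a′ + (q ∸ a′))) % q             ≡⟨ cong (λ t → (c′ + t) % q) (ℕP.+-comm a′ _) ⟩
    (c′ + ((q ∸ a′) + a′)) % q             ≡⟨ +-inverse-%-cancel c′ a ⟩
    c′ % q                                 ≡⟨ toℕ-%-cancel c ⟩
    c′                                     ∎)
    where a′ = toℕ a; c′ = toℕ c

  diffLetter-translates-to : ∀ a b → actLetter q (diffLetter q a b) a ≡ b
  diffLetter-translates-to a b = trans (actLetter-comm _ a) (actLetter-diffLetter a b)

  diffLetter-invariant : ∀ g a b → diffLetter q (actLetter q g a) (actLetter q g b) ≡ diffLetter q a b
  diffLetter-invariant g a b = begin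
    diffLetter q (actLetter q g a) (actLetter q g b)
      ≡⟨ cong (diffLetter q (actLetter q g a) ∘ actLetter q g) (actLetter-diffLetter a b) ⟨
    diffLetter q (actLetter q g a) (actLetter q g (actLetter q a (diffLetter q a b)))
      ≡⟨ cong (diffLetter q (actLetter q g a)) (actLetter-assoc g a _) ⟨
    diffLetter q (actLetter q g a) (actLetter q (actLetter q g a) (diffLetter q a b))
      ≡⟨ diffLetter-actLetter _ _ ⟩
    diffLetter q a b ∎

  length-signature : ∀ a (w : Word q) → length (signature q (a ∷ w)) ≡ length w
  length-signature a []      = refl
  length-signature a (b ∷ w) = cong suc (length-signature b w)

  drop-signature : ∀ i (x : Word q) → drop i (signature q x) ≡ signature q (drop i x)
  drop-signature zero          x           = refl
  drop-signature (suc i)       []          = refl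
  drop-signature (suc zero)    (a ∷ [])    = refl
  drop-signature (suc (suc i)) (a ∷ [])    = refl
  drop-signature (suc i)       (a ∷ b ∷ x) = drop-signature i (b ∷ x)

  take-signature : ∀ k (w : Word q) → take k (signature q w) ≡ signature q (take (suc k) w)
  take-signature zero    []          = refl
  take-signature (suc k) []          = refl
  take-signature zero    (a ∷ [])    = refl
  take-signature zero    (a ∷ b ∷ w) = refl
  take-signature (suc k) (a ∷ [])    = refl
  take-signature (suc k) (a ∷ b ∷ w) = cong (diffLetter q a b ∷_) (take-signature k (b ∷ w))

  signature-act : ∀ g (w : Word q) → signature q (act q g w) ≡ signature q w
  signature-act g []          = refl
  signature-act g (a ∷ [])    = refl
  signature-act g (a ∷ b ∷ w) = cong₂ _∷_ (diffLetter-invariant g a b) (signature-act g (b ∷ w))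

  same-signature⇒act : ∀ g {a b} (u w : Word q) → actLetter q g b ≡ a →
    signature q (a ∷ u) ≡ signature q (b ∷ w) → a ∷ u ≡ act q g (b ∷ w)
  same-signature⇒act g []      []      gb≡a _  = cong (_∷ []) (sym gb≡a)
  same-signature⇒act g []      (d ∷ w) _    ()
  same-signature⇒act g (c ∷ u) []      _    ()
  same-signature⇒act g {a} {b} (c ∷ u) (d ∷ w) gb≡a eq =
    cong₂ _∷_ (sym gb≡a) (same-signature⇒act g u w gd≡c (LP.∷-injectiveʳ eq))
    where
    gd≡c : actLetter q g d ≡ c
    gd≡c = begin
      actLetter q g d                                  ≡⟨ cong (actLetter q g) (actLetter-diffLetter b d) ⟨
      actLetter q g (actLetter q b (diffLetter q b d)) ≡⟨ actLetter-assoc g b _ ⟨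
      actLetter q (actLetter q g b) (diffLetter q b d) ≡⟨ cong₂ (actLetter q) gb≡a (sym (LP.∷-injectiveˡ eq)) ⟩
      actLetter q a (diffLetter q a c)                 ≡⟨ actLetter-diffLetter a c ⟩
      c                                                ∎

  same-signature⇒translate : ∀ (u : Word q) b c r → signature q u ≡ signature q (b ∷ c ∷ r) →
    Σ (Fin q) λ g → u ≡ act q g (b ∷ c ∷ r)
  same-signature⇒translate []          b c r ()
  same-signature⇒translate (a ∷ [])    b c r ()
  same-signature⇒translate (a ∷ d ∷ u) b c r eq =
    g , same-signature⇒act g (d ∷ u) (c ∷ r) (diffLetter-translates-to b a) eq
    where g = diffLetter q b a

  occursAt-lengths : ∀ {w x : Word q} {i k l} → length w ≡ k → length x ≡ l →
    OccursAt w x i ⇔ ((i + k ≤ l) × (take k (drop i x) ≡ w))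
  occursAt-lengths refl refl = mk⇔ id id

  orbitOccursAt⇔occursAt-signature : ∀ b c r a y i →
    OrbitOccursAt q (b ∷ c ∷ r) (a ∷ y) i ⇔ OccursAt (signature q (b ∷ c ∷ r)) (signature q (a ∷ y)) i
  orbitOccursAt⇔occursAt-signature b c r a y i = mk⇔ forward backward
    where
    p = b ∷ c ∷ r
    x = a ∷ y
    m = length r

    window : take (suc m) (drop i (signature q x)) ≡ signature q (take (suc (suc m)) (drop i x))
    window = trans (cong (take (suc m)) (drop-signature i x)) (take-signature (suc m) (drop i x))

    fits⇔ : (i + suc (suc m) ≤ length x) ⇔ (i + suc m ≤ length y)
    fits⇔ = mk⇔ (λ h → ℕP.≤-pred (subst (_≤ length x) (ℕP.+-suc i (suc m)) h))
                (λ h → subst (_≤ length x) (sym (ℕP.+-suc i (suc m))) (s≤s h))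

    occursAt-act : ∀ g → OccursAt (act q g p) x i ⇔
      ((i + suc (suc m) ≤ length x) × (take (suc (suc m)) (drop i x) ≡ act q g p))
    occursAt-act g = occursAt-lengths (LP.length-map (actLetter q g) p) refl

    occursAt-sig : OccursAt (signature q p) (signature q x) i ⇔
      ((i + suc m ≤ length y) × (take (suc m) (drop i (signature q x)) ≡ signature q p))
    occursAt-sig = occursAt-lengths (cong suc (length-signature c r)) (length-signature a y)

    forward : OrbitOccursAt q p x i → OccursAt (signature q p) (signature q x) i
    forward (g , occ) =
      let (fits , eq) = to (occursAt-act g) occ
      in from occursAt-sig (to fits⇔ fits , (begin
           take (suc m) (drop i (signature q x))         ≡⟨ window ⟩
           signature q (take (suc (suc m)) (drop i x))   ≡⟨ cong (signature q) eq ⟩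
           signature q (act q g p)                       ≡⟨ signature-act g p ⟩
           signature q p                                 ∎))

    backward : OccursAt (signature q p) (signature q x) i → OrbitOccursAt q p x i
    backward occ =
      let (fits , eq) = to occursAt-sig occ
          (g , eq′) = same-signature⇒translate _ b c r (trans (sym window) eq)
      in g , from (occursAt-act g) (from fits⇔ fits , eq′)

  ¬orbitOccursAt-length : ∀ b w (x : Word q) → ¬ OrbitOccursAt q (b ∷ w) x (length x)
  ¬orbitOccursAt-length b w x (g , fits , _) = ℕP.m+1+n≰m (length x) fits

  orbitOccurrences-signature : ∀ b c r a y →
    orbitOccurrences q (b ∷ c ∷ r) (a ∷ y) ≡ occurrences (signature q (b ∷ c ∷ r)) (signature q (a ∷ y))
  orbitOccurrences-signature b c r a y = begin
    filter O? (upTo (suc (suc n)))      ≡⟨ cong (filter O?) (LP.upTo-∷ʳ (suc n)) ⟨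
    filter O? (is ∷ʳ suc n)             ≡⟨ LP.filter-++ O? is [ suc n ] ⟩
    filter O? is ++ filter O? [ suc n ] ≡⟨ cong (filter O? is ++_) (LP.filter-reject O? none-at-end) ⟩
    filter O? is ++ []                  ≡⟨ LP.++-identityʳ _ ⟩
    filter O? is                        ≡⟨ LP.filter-≐ O? S? (to (equiv _) , from (equiv _)) is ⟩
    filter S? is                        ≡⟨ cong (λ k → filter S? (upTo (suc k))) (length-signature a y) ⟨
    filter S? (upTo (suc (length (signature q (a ∷ y))))) ∎
    where
    n = length y
    is = upTo (suc n)
    O? = orbitOccursAt? q (b ∷ c ∷ r) (a ∷ y)
    S? = occursAt? (signature q (b ∷ c ∷ r)) (signature q (a ∷ y))
    equiv = orbitOccursAt⇔occursAt-signature b c r a y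
    none-at-end = ¬orbitOccursAt-length b (c ∷ r) (a ∷ y)

sum-const : ∀ n c → sum {n} (λ _ → c) ≡ n * c
sum-const zero    c = refl
sum-const (suc n) c = cong (c +_) (sum-const n c)

module _ {a b p} {A : Set a} {B : Set b} {P : Pred A p} (P? : Decidable P) where

  length-filter-map : (f : B → A) (xs : List B) →
    length (filter P? (map f xs)) ≡ length (filter (P? ∘ f) xs)
  length-filter-map f []       = refl
  length-filter-map f (x ∷ xs) with does (P? (f x))
  ... | true  = cong suc (length-filter-map f xs)
  ... | false = length-filter-map f xs

  length-filter-concatMap : ∀ {n} (f : B → List A) (g : Fin n → B) →
    length (filter P? (concatMap f (tabulate g))) ≡ sum (λ i → length (filter P? (f (g i))))
  length-filter-concatMap {zero}  f g = refl
  length-filter-concatMap {suc n} f g = begin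
    length (filter P? (first ++ rest))                  ≡⟨ cong length (LP.filter-++ P? first rest) ⟩
    length (filter P? first ++ filter P? rest)          ≡⟨ LP.length-++ (filter P? first) ⟩
    length (filter P? first) + length (filter P? rest)  ≡⟨ cong (length (filter P? first) +_)
                                                             (length-filter-concatMap f (g ∘ Fin.suc)) ⟩
    sum (λ i → length (filter P? (f (g i))))            ∎
    where
    first = f (g Fin.zero)
    rest  = concatMap f (tabulate (g ∘ Fin.suc))

module _ {q : ℕ} .{{_ : NonZero q}} where

  countWords-suc : ∀ n {P : Pred (Word q) _} (P? : Decidable P) →
    countWords q (suc n) P? ≡ sum (λ a → countWords q n (P? ∘ (a ∷_)))
  countWords-suc n P? = trans (length-filter-concatMap P? (λ a → map (a ∷_) (words q n)) id)
                              (sum-cong-≗ (λ a → length-filter-map P? (a ∷_) (words q n)))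

  countWords-signature-cons : ∀ n a {R : Pred (Word q) _} (R? : Decidable R) →
    countWords q n (λ y → R? (signature q (a ∷ y))) ≡ countWords q n R?
  countWords-signature-cons zero    a R? with R? []
  ... | yes _ = refl
  ... | no  _ = refl
  countWords-signature-cons (suc n) a R? = begin
    countWords q (suc n) (λ y → R? (signature q (a ∷ y)))        ≡⟨ countWords-suc n _ ⟩
    sum (λ b → countWords q n (λ y → R? (signature q (a ∷ b ∷ y))))
      ≡⟨ sum-cong-≗ (λ b → countWords-signature-cons n b (λ s → R? (diffLetter q a b ∷ s))) ⟩
    sum (count-from ∘ diffLetter q a)                             ≡⟨ sum-permute count-from translation ⟨
    sum count-from                                                ≡⟨ countWords-suc n R? ⟨
    countWords q (suc n) R?                                       ∎
    where
    count-from : Fin q → ℕ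
    count-from c = countWords q n (λ s → R? (c ∷ s))
    translation =
      permutation (diffLetter q a) (actLetter q a) (diffLetter-actLetter a) (actLetter-diffLetter a)

  countWords-suc-signature : ∀ n {P Q : Pred (Word q) _} (P? : Decidable P) (Q? : Decidable Q) →
    (∀ a y → P (a ∷ y) ⇔ Q (signature q (a ∷ y))) →
    countWords q (suc n) P? ≡ q * countWords q n Q?
  countWords-suc-signature n P? Q? P⇔Q = begin
    countWords q (suc n) P?                    ≡⟨ countWords-suc n P? ⟩
    sum (λ a → countWords q n (P? ∘ (a ∷_)))   ≡⟨ sum-cong-≗ count-by-signature ⟩
    sum {q} (λ _ → countWords q n Q?)          ≡⟨ sum-const q _ ⟩
    q * countWords q n Q?                      ∎
    where
    count-by-signature : ∀ a → countWords q n (P? ∘ (a ∷_)) ≡ countWords q n Q?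
    count-by-signature a = trans
      (cong length (LP.filter-≐ (P? ∘ (a ∷_)) (λ y → Q? (signature q (a ∷ y)))
                                (to (P⇔Q a _) , from (P⇔Q a _)) (words q n)))
      (countWords-signature-cons n a Q?)

≡-resp-⇔ : ∀ {a} {A : Set a} {x x′ y y′ : A} → x ≡ x′ → y ≡ y′ → (x ≡ y) ⇔ (x′ ≡ y′)
≡-resp-⇔ x≡x′ y≡y′ = mk⇔ (subst₂ _≡_ x≡x′ y≡y′) (subst₂ _≡_ (sym x≡x′) (sym y≡y′))

module _ {q : ℕ} .{{_ : NonZero q}} (b c : Fin q) (r : Word q) where

  private
    avoids? : Decidable (AvoidsOrbit q (b ∷ c ∷ r))
    avoids? x = LP.≡-dec ℕP._≟_ (orbitOccurrences q (b ∷ c ∷ r) x) []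

    onlyAtEnd? : Decidable (OrbitOnlyAtEnd q (b ∷ c ∷ r))
    onlyAtEnd? x = LP.≡-dec ℕP._≟_ (orbitOccurrences q (b ∷ c ∷ r) x) [ length x ∸ length (b ∷ c ∷ r) ]

  orbitOccurrences-[] : orbitOccurrences q (b ∷ c ∷ r) [] ≡ []
  orbitOccurrences-[] =
    LP.filter-reject (orbitOccursAt? q (b ∷ c ∷ r) []) (¬orbitOccursAt-length b (c ∷ r) [])

  ¬orbitOnlyAtEnd-[] : ¬ OrbitOnlyAtEnd q (b ∷ c ∷ r) []
  ¬orbitOnlyAtEnd-[] eq = case trans (sym orbitOccurrences-[]) eq of λ ()

  𝒢-signature : 𝒢 q (b ∷ c ∷ r) ≈ˢ 𝟙 +ˢ q ·ˢ z· GF q (signature q (b ∷ c ∷ r))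
  𝒢-signature zero    = trans (cong length (LP.filter-accept avoids? orbitOccurrences-[]))
                              (cong suc (sym (ℕP.*-zeroʳ q)))
  𝒢-signature (suc n) = countWords-suc-signature n avoids? _ λ a y →
    ≡-resp-⇔ (orbitOccurrences-signature b c r a y) refl

  𝒢-end-signature : 𝒢-end q (b ∷ c ∷ r) ≈ˢ q ·ˢ z· GF-end q (signature q (b ∷ c ∷ r))
  𝒢-end-signature zero    = trans (cong length (LP.filter-reject onlyAtEnd? ¬orbitOnlyAtEnd-[]))
                                  (sym (ℕP.*-zeroʳ q))
  𝒢-end-signature (suc n) = countWords-suc-signature n onlyAtEnd? _ λ a y →
    ≡-resp-⇔ (orbitOccurrences-signature b c r a y)
             (cong [_] (cong₂ _∸_ (sym (length-signature a y)) (cong suc (sym (length-signature c r)))))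

mainTheorem7 : (q : ℕ) .{{_ : NonZero q}} (p : Word q) → 2 ≤ length p →
    (𝒢 q p ≈ˢ 𝟙 +ˢ q ·ˢ z· GF q (signature q p))
    × (𝒢-end q p ≈ˢ q ·ˢ z· GF-end q (signature q p))
mainTheorem7 q (_ ∷ [])    (s≤s ())
mainTheorem7 q (b ∷ c ∷ r) _ = 𝒢-signature b c r , 𝒢-end-signature b c r
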